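{- Let $r_1\mid r_2\mid\cdots\mid r_n$ be positive integers and let $\vec\beta,\vec\beta'\in\mathcal R'$. Then $\vec\beta\sim\vec\beta'$ if and only if there exists an integer $1\le m\le e(\vec\beta)$ with $\gcd(m,e(\vec\beta))=1$ such that $\vec\beta'=m\vec\beta$.
   Context: $\mathcal R'$ is the set of integer vectors $\vec\beta=(\beta_1,\dots,\beta_n)$ with $0\le\beta_j\le r_j-1$. Let $\mathcal R^\dagger=\{1,\dots,r_1\}\times\cdots\times\{1,\dots,r_n\}$ and $A_{\vec\beta}=\{\vec\omega\in\mathcal R^\dagger:\sum_{j=1}^n\frac{r_n}{r_j}\omega_j\beta_j\equiv0\pmod{r_n}\}$; $\vec\beta\sim\vec\beta'$ means $A_{\vec\beta}=A_{\vec\beta'}$. $e(\vec\beta)=\operatorname{lcm}_{j}\frac{r_j}{\gcd(r_j,\beta_j)}$ with $\gcd(r_j,0)=r_j$. For an integer $m$, $m\vec\beta$ denotes the vector whose $j$-th entry is the least non-negative residue of $m\beta_j$ modulo $r_j$. -}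

module Defs where

open import Data.Nat using (ℕ; zero; suc; _+_; _*_; _≤_; _<_)
open import Data.Nat.DivMod using (_/_; _%_)
open import Data.Nat.GCD using (gcd)
open import Data.Nat.LCM using (lcm)
open import Data.Nat.Divisibility using (_∣_)
open import Data.Fin using (Fin; fromℕ; inject₁)
open import Data.Vec using (tabulate; sum)
open import Data.List using (List; foldr; map; allFin)
open import Data.Product using (_×_)
open import Function.Bundles using (_⇔_)

-- Total versions of division / remainder (only used with positive divisors).
_÷_ : ℕ → ℕ → ℕ
m ÷ zero    = 0
m ÷ (suc k) = m / suc k

_mod_ : ℕ → ℕ → ℕ
m mod zero    = m
m mod (suc k) = m % suc k

-- r : Fin (suc n) → ℕ is (r_1,…,r_{n+1}); the last modulus r_n of the paper is rLast r.
rLast : ∀ {n} → (Fin (suc n) → ℕ) → ℕ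
rLast {n} r = r (fromℕ n)

Positive : ∀ {n} → (Fin (suc n) → ℕ) → Set
Positive r = ∀ j → 0 < r j

DivChain : ∀ {n} → (Fin (suc n) → ℕ) → Set
DivChain {n} r = (j : Fin n) → r (inject₁ j) ∣ r (Fin.suc j)

InR' : ∀ {n} → (Fin (suc n) → ℕ) → (Fin (suc n) → ℕ) → Set
InR' r β = ∀ j → β j < r j

InRdag : ∀ {n} → (Fin (suc n) → ℕ) → (Fin (suc n) → ℕ) → Set
InRdag r ω = ∀ j → (1 ≤ ω j) × (ω j ≤ r j)

-- ω ∈ A_β : ∑_j (r_n / r_j) ω_j β_j ≡ 0 (mod r_n)   (ω ∈ R† required separately)
InA : ∀ {n} → (Fin (suc n) → ℕ) → (β ω : Fin (suc n) → ℕ) → Set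
InA r β ω = rLast r ∣ sum (tabulate (λ j → (rLast r ÷ r j) * ω j * β j))

Equiv : ∀ {n} → (Fin (suc n) → ℕ) → (β β' : Fin (suc n) → ℕ) → Set
Equiv r β β' = ∀ ω → InRdag r ω → (InA r β ω ⇔ InA r β' ω)

-- e(β) = lcm_j r_j / gcd(r_j, β_j)   (gcd r 0 = r in the stdlib)
e : ∀ {n} → (Fin (suc n) → ℕ) → (Fin (suc n) → ℕ) → ℕ
e {n} r β = foldr lcm 1 (map (λ j → r j ÷ gcd (r j) (β j)) (allFin (suc n)))

scale : ∀ {n} → (Fin (suc n) → ℕ) → ℕ → (Fin (suc n) → ℕ) → (Fin (suc n) → ℕ)
scale r m β j = (m * β j) mod r j

-- Put N = r_n and c_j = (N / r_j) β_j.  Since ω ↦ Σ_j c_j ω_j modulo N only depends on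
-- ω_j modulo r_j, A_β is the kernel on all of ℤⁿ of this character ℤⁿ → ℤ/N.  Its image
-- is the cyclic group of order E = e(β) generated by Y = N / E: E annihilates every c_j,
-- because r_j / gcd(r_j, β_j) divides E, and Y is a value, by Bézout for each
-- gcd(r_j, β_j) followed by Bézout for the lcm's.  If the kernel of c is contained in
-- that of c′, then c′ factors through c: c′ ≡ m c (mod N), and m may be reduced into
-- {1, …, E}.  If gcd(m, E) = g > 1, then (E / g) ω₀, for ω₀ with value Y, lies in the
-- kernel of c′ but not in that of c.  Conversely, a multiplier prime to E preserves the
-- kernel, and c′ ≡ m c (mod N) says exactly that β′ = m β.
module Submission where

open import Defs
open import Data.Nat using (ℕ; suc; _≤_)
open import Data.Nat.GCD using (gcd)
open import Data.Fin using (Fin)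
open import Data.Product using (_×_; ∃-syntax)
open import Relation.Binary.PropositionalEquality using (_≡_)
open import Function.Bundles using (_⇔_)

open import Data.Fin using (zero; suc; fromℕ)
open import Data.Integer as ℤ using (ℤ; +_; _+_; _*_; -_; _-_; 0ℤ; 1ℤ; _%ℕ_; _/ℕ_)
open import Data.Integer.Coprimality using (coprime-divisor)
open import Data.Integer.Divisibility.Signed
  using (_∣_; divides; ∣ᵤ⇒∣; ∣⇒∣ᵤ; ∣-refl; ∣-trans; ∣m∣n⇒∣m+n; ∣m∣n⇒∣m-n; ∣m⇒∣-m; ∣n⇒∣m*n; ∣m⇒∣m*n;
         *-monoʳ-∣; *-monoˡ-∣; *-cancelˡ-∣; *-cancelʳ-∣; module ∣-Reasoning)
open import Data.Integer.DivMod using (n%ℕd<d; a≡a%ℕn+[a/ℕn]*n)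
import Data.Integer.Properties as ℤ
open import Algebra.Properties.Semiring.Sum ℤ.+-*-semiring
  using (sum; sum-cong-≗; ∑-distrib-+; *-distribˡ-sum)
open import Data.Integer.Tactic.RingSolver using (solve-∀)
open import Data.List using ([]; _∷_; foldr; map; allFin)
open import Data.List.Membership.Propositional using (_∈_)
open import Data.List.Membership.Propositional.Properties using (∈-map⁺; ∈-allFin)
open import Data.List.Relation.Unary.Any using (here; there)
open import Data.Nat as ℕ using (zero; z≤n; s≤s)
open import Data.Nat.Coprimality using (gcd≡1⇒coprime) renaming (sym to coprime-sym)
open import Data.Nat.Divisibility as ℕ using () renaming (_∣_ to _∣ₙ_)
import Data.Nat.DivMod as ℕ
open import Data.Nat.GCD using (gcd-GCD; module Bézout; gcd[m,n]∣m; gcd[m,n]∣n; gcd[m,n]≢0)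
open import Data.Nat.LCM using (lcm; gcd*lcm; m∣lcm[m,n]; n∣lcm[m,n])
import Data.Nat.Properties as ℕ
open import Algebra.Properties.CommutativeSemigroup ℕ.*-commutativeSemigroup
  using (xy∙z≈xz∙y; x∙yz≈y∙xz)
open import Data.Product using (∃; ∃₂; _,_; proj₁; proj₂)
open import Data.Sum using (inj₁; [_,_]′)
open import Data.Vec as Vec using (tabulate)
open import Function.Bundles using (mk⇔; Equivalence)
open import Function.Related.Propositional using (module EquationalReasoning)
open import Level using (0ℓ)
open import Relation.Binary.PropositionalEquality
  using (_≢_; refl; sym; trans; cong; cong₂; subst; subst₂; module ≡-Reasoning)
open import Relation.Unary using (Pred; _⊆′_; _≐′_)

-- Linear forms on ℤᵏ and their kernels modulo N

⟪_,_⟫ : ∀ {k} → (Fin k → ℤ) → (Fin k → ℤ) → ℤ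
⟪ c , ω ⟫ = sum (λ j → c j * ω j)

δ : ∀ {k} → Fin k → Fin k → ℤ
δ zero    zero    = 1ℤ
δ zero    (suc _) = 0ℤ
δ (suc _) zero    = 0ℤ
δ (suc i) (suc j) = δ i j

⟪⟫-zeroʳ : ∀ {k} (c : Fin k → ℤ) → ⟪ c , (λ _ → 0ℤ) ⟫ ≡ 0ℤ
⟪⟫-zeroʳ {zero}  c = refl
⟪⟫-zeroʳ {suc k} c = cong₂ _+_ (ℤ.*-zeroʳ (c zero)) (⟪⟫-zeroʳ (λ j → c (suc j)))

⟪⟫-δʳ : ∀ {k} (c : Fin k → ℤ) i → ⟪ c , δ i ⟫ ≡ c i
⟪⟫-δʳ c zero    = trans (cong₂ _+_ (ℤ.*-identityʳ (c zero)) (⟪⟫-zeroʳ (λ j → c (suc j))))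
                        (ℤ.+-identityʳ (c zero))
⟪⟫-δʳ c (suc i) = begin
  c zero * 0ℤ + ⟪ c′ , δ i ⟫  ≡⟨ cong (_+ ⟪ c′ , δ i ⟫) (ℤ.*-zeroʳ (c zero)) ⟩
  0ℤ + ⟪ c′ , δ i ⟫           ≡⟨ ℤ.+-identityˡ _ ⟩
  ⟪ c′ , δ i ⟫                ≡⟨ ⟪⟫-δʳ c′ i ⟩
  c′ i                        ∎
  where
  open ≡-Reasoning
  c′ : Fin _ → ℤ
  c′ j = c (suc j)

⟪⟫-*ʳ : ∀ {k} (c : Fin k → ℤ) a ω → ⟪ c , (λ j → a * ω j) ⟫ ≡ a * ⟪ c , ω ⟫
⟪⟫-*ʳ c a ω = trans (sum-cong-≗ (λ j → swap a (c j) (ω j))) (sym (*-distribˡ-sum a (λ j → c j * ω j)))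
  where
  swap : ∀ a x y → x * (a * y) ≡ a * (x * y)
  swap = solve-∀

⟪⟫-linearʳ : ∀ {k} (c : Fin k → ℤ) a b ω ω′ →
             ⟪ c , (λ j → a * ω j + b * ω′ j) ⟫ ≡ a * ⟪ c , ω ⟫ + b * ⟪ c , ω′ ⟫
⟪⟫-linearʳ c a b ω ω′ = begin
  sum (λ j → c j * (a * ω j + b * ω′ j))
    ≡⟨ sum-cong-≗ (λ j → distrib a b (c j) (ω j) (ω′ j)) ⟩
  sum (λ j → a * (c j * ω j) + b * (c j * ω′ j))
    ≡⟨ ∑-distrib-+ (λ j → a * (c j * ω j)) (λ j → b * (c j * ω′ j)) ⟩
  sum (λ j → a * (c j * ω j)) + sum (λ j → b * (c j * ω′ j))
    ≡⟨ sym (cong₂ _+_ (*-distribˡ-sum a (λ j → c j * ω j)) (*-distribˡ-sum b (λ j → c j * ω′ j))) ⟩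
  a * ⟪ c , ω ⟫ + b * ⟪ c , ω′ ⟫
    ∎
  where
  open ≡-Reasoning
  distrib : ∀ a b x y z → x * (a * y + b * z) ≡ a * (x * y) + b * (x * z)
  distrib = solve-∀

∣-sub⇒∣⇔∣ : ∀ {N a b} → N ∣ a - b → (N ∣ a ⇔ N ∣ b)
∣-sub⇒∣⇔∣ {N} {a} {b} N∣a-b = mk⇔
  (λ N∣a → subst (N ∣_) (a-[a-b]≡b a b) (∣m∣n⇒∣m-n N∣a N∣a-b))
  (λ N∣b → subst (N ∣_) ([a-b]+b≡a a b) (∣m∣n⇒∣m+n N∣a-b N∣b))
  where
  a-[a-b]≡b : ∀ a b → a - (a - b) ≡ b
  a-[a-b]≡b = solve-∀
  [a-b]+b≡a : ∀ a b → a - b + b ≡ a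
  [a-b]+b≡a = solve-∀

sum-∣ : ∀ {k N} (f : Fin k → ℤ) → (∀ j → N ∣ f j) → N ∣ sum f
sum-∣ {zero}  f _ = divides 0ℤ refl
sum-∣ {suc k} f h = ∣m∣n⇒∣m+n (h zero) (sum-∣ (λ j → f (suc j)) (λ j → h (suc j)))

sum-cong-mod : ∀ {k N} (f g : Fin k → ℤ) → (∀ j → N ∣ f j - g j) → N ∣ sum f - sum g
sum-cong-mod {zero}      f g _ = divides 0ℤ refl
sum-cong-mod {suc k} {N} f g h = begin
  N                                    ∣⟨ ∣m∣n⇒∣m+n (h zero) (sum-cong-mod f′ g′ (λ j → h (suc j))) ⟩
  f zero - g zero + (sum f′ - sum g′)  ≡⟨ interchange (f zero) (g zero) (sum f′) (sum g′) ⟩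
  f zero + sum f′ - (g zero + sum g′)  ∎
  where
  open ∣-Reasoning
  f′ g′ : Fin k → ℤ
  f′ j = f (suc j)
  g′ j = g (suc j)
  interchange : ∀ a b c d → a - b + (c - d) ≡ a + c - (b + d)
  interchange = solve-∀

⟪⟫-congˡ-mod : ∀ {k N} m {c c′ : Fin k → ℤ} → (∀ j → N ∣ c′ j - m * c j) →
               ∀ ω → N ∣ ⟪ c′ , ω ⟫ - m * ⟪ c , ω ⟫
⟪⟫-congˡ-mod {N = N} m {c} {c′} h ω = begin
  N                                          ∣⟨ sum-cong-mod (λ j → c′ j * ω j) (λ j → m * (c j * ω j)) N∣term ⟩
  ⟪ c′ , ω ⟫ - sum (λ j → m * (c j * ω j))   ≡⟨ cong (λ s → ⟪ c′ , ω ⟫ - s) (sym (*-distribˡ-sum m (λ j → c j * ω j))) ⟩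
  ⟪ c′ , ω ⟫ - m * ⟪ c , ω ⟫                 ∎
  where
  open ∣-Reasoning
  factor : ∀ x m y w → (x - m * y) * w ≡ x * w - m * (y * w)
  factor = solve-∀
  N∣term : ∀ j → N ∣ c′ j * ω j - m * (c j * ω j)
  N∣term j = subst (N ∣_) (factor (c′ j) m (c j) (ω j)) (∣m⇒∣m*n (ω j) (h j))

⟪⟫-congʳ-mod : ∀ {k N} {c ω ω′ : Fin k → ℤ} → (∀ j → N ∣ c j * (ω j - ω′ j)) →
               N ∣ ⟪ c , ω ⟫ - ⟪ c , ω′ ⟫
⟪⟫-congʳ-mod {N = N} {c} {ω} {ω′} h =
  sum-cong-mod (λ j → c j * ω j) (λ j → c j * ω′ j) (λ j → subst (N ∣_) (distrib (c j) (ω j) (ω′ j)) (h j))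
  where
  distrib : ∀ x y z → x * (y - z) ≡ x * y - x * z
  distrib = solve-∀

Ker : ∀ {k} → ℤ → (Fin k → ℤ) → Pred (Fin k → ℤ) 0ℓ
Ker N c ω = N ∣ ⟪ c , ω ⟫

Attained : ∀ {k} → ℤ → (Fin k → ℤ) → Pred ℤ 0ℓ
Attained N c y = ∃ λ ω → N ∣ ⟪ c , ω ⟫ - y

AttainedCofactor : ∀ {k} → ℤ → (Fin k → ℤ) → Pred ℕ 0ℓ
AttainedCofactor N c A = ∃ λ y → + A * y ≡ N × Attained N c y

multiple⇒Ker⊆ : ∀ {k N} m {c c′ : Fin k → ℤ} → (∀ j → N ∣ c′ j - m * c j) → Ker N c ⊆′ Ker N c′
multiple⇒Ker⊆ m {c} {c′} h ω ω∈Ker =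
  Equivalence.from (∣-sub⇒∣⇔∣ (⟪⟫-congˡ-mod m {c} {c′} h ω)) (∣n⇒∣m*n m ω∈Ker)

module _ {k} {N : ℤ} {c : Fin k → ℤ} where

  attained-coeff : ∀ j → Attained N c (c j)
  attained-coeff j = δ j , divides 0ℤ (trans (cong (_- c j) (⟪⟫-δʳ c j)) (ℤ.+-inverseʳ (c j)))

  attained-modulus : Attained N c N
  attained-modulus = (λ _ → 0ℤ) , subst (λ x → N ∣ x - N) (sym (⟪⟫-zeroʳ c))
                                    (subst (N ∣_) (sym (ℤ.+-identityˡ (- N))) (∣m⇒∣-m ∣-refl))

  attained-linear : ∀ {y y′} a b → Attained N c y → Attained N c y′ → Attained N c (a * y + b * y′)
  attained-linear {y} {y′} a b (ω , h) (ω′ , h′) = (λ j → a * ω j + b * ω′ j) , (begin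
    N                                                      ∣⟨ ∣m∣n⇒∣m+n (∣n⇒∣m*n a h) (∣n⇒∣m*n b h′) ⟩
    a * (⟪ c , ω ⟫ - y) + b * (⟪ c , ω′ ⟫ - y′)            ≡⟨ regroup a b ⟪ c , ω ⟫ y ⟪ c , ω′ ⟫ y′ ⟩
    a * ⟪ c , ω ⟫ + b * ⟪ c , ω′ ⟫ - (a * y + b * y′)      ≡⟨ cong (_- (a * y + b * y′)) (sym (⟪⟫-linearʳ c a b ω ω′)) ⟩
    ⟪ c , (λ j → a * ω j + b * ω′ j) ⟫ - (a * y + b * y′)  ∎)
    where
    open ∣-Reasoning
    regroup : ∀ a b x y x′ y′ → a * (x - y) + b * (x′ - y′) ≡ a * x + b * x′ - (a * y + b * y′)
    regroup = solve-∀

-- Arithmetic of ℕ and ℤ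

bézout : ∀ m n → ∃₂ λ x y → + gcd m n ≡ x * + m + y * + n
bézout m n = fromIdentity (Bézout.identity (gcd-GCD m n))
  where
  isolate : ∀ d y n {a} → d + y * n ≡ a → d ≡ a + - y * n
  isolate d y n refl = cancel d y n
    where
    cancel : ∀ d y n → d ≡ d + y * n + - y * n
    cancel = solve-∀
  lift : ∀ d a b c e → d ℕ.+ a ℕ.* b ≡ c ℕ.* e → + d + + a * + b ≡ + c * + e
  lift d a b c e eq = begin
    + d + + a * + b   ≡⟨ cong (λ t → + d + t) (ℤ.pos-* a b) ⟨
    + d + + (a ℕ.* b) ≡⟨ ℤ.pos-+ d (a ℕ.* b) ⟨
    + (d ℕ.+ a ℕ.* b) ≡⟨ cong +_ eq ⟩
    + (c ℕ.* e)       ≡⟨ ℤ.pos-* c e ⟩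
    + c * + e         ∎
    where open ≡-Reasoning
  fromIdentity : ∀ {d} → Bézout.Identity d m n → ∃₂ λ x y → + d ≡ x * + m + y * + n
  fromIdentity {d} (Bézout.+- x y eq) = + x , - + y , isolate (+ d) (+ y) (+ n) (lift d y n x m eq)
  fromIdentity {d} (Bézout.-+ x y eq) =
    - + x , + y , trans (isolate (+ d) (+ x) (+ m) (lift d x m y n eq)) (ℤ.+-comm (+ y * + n) _)

lcm-combination : ∀ {A B x y} {N a b : ℤ} → A ≢ 0 → + gcd A B ≡ x * + A + y * + B →
                  + A * a ≡ N → + B * b ≡ N → + lcm A B * (x * b + y * a) ≡ N
lcm-combination {A} {B} {x} {y} {N} {a} {b} A≢0 G≡ Aa≡N Bb≡N = ℤ.*-cancelˡ-≡ (+ G) _ _ {{G-nonZero}} (begin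
  + G * (+ L * (x * b + y * a))              ≡⟨ ℤ.*-assoc (+ G) (+ L) _ ⟨
  + G * + L * (x * b + y * a)                ≡⟨ cong (_* (x * b + y * a)) GL≡AB ⟩
  + A * + B * (x * b + y * a)                ≡⟨ expand (+ A) (+ B) x y a b ⟩
  x * + A * (+ B * b) + y * + B * (+ A * a)  ≡⟨ cong₂ (λ u v → x * + A * u + y * + B * v) Bb≡N Aa≡N ⟩
  x * + A * N + y * + B * N                  ≡⟨ ℤ.*-distribʳ-+ N (x * + A) (y * + B) ⟨
  (x * + A + y * + B) * N                    ≡⟨ cong (_* N) G≡ ⟨
  + G * N                                    ∎)
  where
  open ≡-Reasoning
  G L : ℕ
  G = gcd A B
  L = lcm A B
  G-nonZero : ℤ.NonZero (+ G)
  G-nonZero = ℤ.≢-nonZero (λ G≡0 → gcd[m,n]≢0 A B (inj₁ A≢0) (ℤ.+-injective G≡0))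
  GL≡AB : + G * + L ≡ + A * + B
  GL≡AB = trans (sym (ℤ.pos-* G L)) (trans (cong +_ (gcd*lcm A B)) (ℤ.pos-* A B))
  expand : ∀ A B x y a b → A * B * (x * b + y * a) ≡ x * A * (B * b) + y * B * (A * a)
  expand = solve-∀

attained-lcm : ∀ {k N} {c : Fin k → ℤ} {A B} → A ≢ 0 →
               AttainedCofactor N c A → AttainedCofactor N c B → AttainedCofactor N c (lcm A B)
attained-lcm {N = N} {c} {A} {B} A≢0 (a , Aa≡N , a-attained) (b , Bb≡N , b-attained) = combine (bézout A B)
  where
  combine : (∃₂ λ x y → + gcd A B ≡ x * + A + y * + B) → AttainedCofactor N c (lcm A B)
  combine (x , y , G≡) = x * b + y * a , lcm-combination {x = x} {y} A≢0 G≡ Aa≡N Bb≡N ,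
                         attained-linear {c = c} x y b-attained a-attained

-- The representative of a modulo n in {1, …, n}, the range of the coordinates of R†.
_mod⁺_ : ℤ → (n : ℕ) → .{{ℕ.NonZero n}} → ℕ
a mod⁺ n = suc ((a - 1ℤ) %ℕ n)

mod⁺-≤ : ∀ a n .{{_ : ℕ.NonZero n}} → a mod⁺ n ≤ n
mod⁺-≤ a n = n%ℕd<d (a - 1ℤ) n

mod⁺-∣ : ∀ a n .{{_ : ℕ.NonZero n}} → + n ∣ a - + (a mod⁺ n)
mod⁺-∣ a n = divides q (begin
  a - (1ℤ + + ρ)        ≡⟨ shift a (+ ρ) ⟩
  (a - 1ℤ) - + ρ        ≡⟨ cong (_- + ρ) (a≡a%ℕn+[a/ℕn]*n (a - 1ℤ) n) ⟩
  + ρ + q * + n - + ρ   ≡⟨ cancel (+ ρ) (q * + n) ⟩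
  q * + n               ∎)
  where
  open ≡-Reasoning
  ρ : ℕ
  ρ = (a - 1ℤ) %ℕ n
  q : ℤ
  q = (a - 1ℤ) /ℕ n
  shift : ∀ a r → a - (1ℤ + r) ≡ a - 1ℤ - r
  shift = solve-∀
  cancel : ∀ r x → r + x - r ≡ x
  cancel = solve-∀

multiple-below⇒≡0 : ∀ {R x} → x ℕ.< R → R ∣ₙ x → x ≡ 0
multiple-below⇒≡0 {suc _} {x} x<R R∣x = trans (sym (ℕ.m<n⇒m%n≡m x<R)) (ℕ.n∣m⇒m%n≡0 x _ R∣x)

residue-unique : ∀ {R b b′} → b ℕ.< R → b′ ℕ.< R → + R ∣ + b - + b′ → b ≡ b′
residue-unique {R} {b} {b′} b<R b′<R R∣b-b′ =
  [ (λ b≤b′ → ordered b≤b′ b′<R R∣∣b-b′∣)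
  , (λ b′≤b → sym (ordered b′≤b b<R (subst (R ∣ₙ_) (ℤ.∣i-j∣≡∣j-i∣ (+ b) (+ b′)) R∣∣b-b′∣)))
  ]′ (ℕ.≤-total b b′)
  where
  R∣∣b-b′∣ : R ∣ₙ ℤ.∣ + b - + b′ ∣
  R∣∣b-b′∣ = ∣⇒∣ᵤ R∣b-b′
  ordered : ∀ {x y} → x ≤ y → y ℕ.< R → R ∣ₙ ℤ.∣ + x - + y ∣ → x ≡ y
  ordered {x} {y} x≤y y<R R∣ = ℕ.≤-antisym x≤y (ℕ.m∸n≡0⇒m≤n
    (multiple-below⇒≡0 (ℕ.≤-<-trans (ℕ.m∸n≤m y x) y<R)
      (subst (R ∣ₙ_) (trans (cong ℤ.∣_∣ (ℤ.m-n≡m⊖n x y)) (ℤ.∣⊖∣-≤ x≤y)) R∣)))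

∣-sub⇔≡mod : ∀ {R a b} → 0 ℕ.< R → b ℕ.< R → (+ R ∣ + b - + a ⇔ b ≡ a mod R)
∣-sub⇔≡mod {suc k} {a} {b} _ b<R = mk⇔
  (λ R∣b-a → residue-unique b<R (ℕ.m%n<n a R)
               (subst (+ R ∣_) (cancel (+ b) (+ a) (+ (a ℕ.% R))) (∣m∣n⇒∣m-n R∣b-a R∣[a%R]-a)))
  (λ { refl → R∣[a%R]-a })
  where
  R : ℕ
  R = suc k
  cancel : ∀ b a r → b - a - (r - a) ≡ b - r
  cancel = solve-∀
  R∣[a%R]-a : + R ∣ + (a ℕ.% R) - + a
  R∣[a%R]-a = divides (- (+ a /ℕ R)) (begin
    + (a ℕ.% R) - + a                               ≡⟨ cong (λ v → + (a ℕ.% R) - v) (a≡a%ℕn+[a/ℕn]*n (+ a) R) ⟩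
    + (a ℕ.% R) - (+ (a ℕ.% R) + (+ a /ℕ R) * + R)  ≡⟨ cancel′ (+ (a ℕ.% R)) (+ a /ℕ R) (+ R) ⟩
    - (+ a /ℕ R) * + R                              ∎)
    where
    open ≡-Reasoning
    cancel′ : ∀ r q R → r - (r + q * R) ≡ - q * R
    cancel′ = solve-∀

∈⇒∣foldr-lcm : ∀ {x xs} → x ∈ xs → x ∣ₙ foldr lcm 1 xs
∈⇒∣foldr-lcm {xs = y ∷ ys} (here refl)  = m∣lcm[m,n] y (foldr lcm 1 ys)
∈⇒∣foldr-lcm {xs = y ∷ ys} (there x∈ys) = ℕ.∣-trans (∈⇒∣foldr-lcm x∈ys) (n∣lcm[m,n] y (foldr lcm 1 ys))

pos-sum-tabulate : ∀ {k} (f : Fin k → ℕ) → + Vec.sum (tabulate f) ≡ sum (λ j → + f j)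
pos-sum-tabulate {zero}  f = refl
pos-sum-tabulate {suc k} f =
  trans (ℤ.pos-+ (f zero) _) (cong (λ s → + f zero + s) (pos-sum-tabulate (λ j → f (suc j))))

÷*-cancel : ∀ {a b} → 0 ℕ.< b → b ∣ₙ a → a ÷ b ℕ.* b ≡ a
÷*-cancel {b = suc _} _ b∣a = ℕ.m/n*n≡m b∣a

-- The values of ⟪ c , _ ⟫ modulo N form the cyclic group of order E generated by Y.
record CyclicImage {k} (N : ℤ) (c : Fin k → ℤ) (E : ℕ) (Y : ℤ) : Set where
  field
    modulus≢0           : N ≢ 0ℤ
    order*generator≡N   : + E * Y ≡ N
    modulus∣order*coeff : ∀ j → N ∣ + E * c j
    generator-attained  : Attained N c Y

module _ {k} {N : ℤ} {c : Fin k → ℤ} {E : ℕ} {Y : ℤ} (img : CyclicImage N c E Y) where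
  open CyclicImage img

  private
    instance
      order-nonZero : ℕ.NonZero E
      order-nonZero = ℕ.≢-nonZero λ E≡0 →
        modulus≢0 (trans (sym order*generator≡N) (cong (λ e → + e * Y) E≡0))
      generator-nonZero : ℤ.NonZero Y
      generator-nonZero = ℤ.≢-nonZero λ Y≡0 →
        modulus≢0 (trans (sym order*generator≡N) (trans (cong (+ E *_) Y≡0) (ℤ.*-zeroʳ (+ E))))

    ω₀ : Fin k → ℤ
    ω₀ = proj₁ generator-attained

    N∣⟪c,ω₀⟫-Y : N ∣ ⟪ c , ω₀ ⟫ - Y
    N∣⟪c,ω₀⟫-Y = proj₂ generator-attained

  generator∣coeff : ∀ j → Y ∣ c j
  generator∣coeff j = *-cancelˡ-∣ (+ E) (subst (_∣ _) (sym order*generator≡N) (modulus∣order*coeff j))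

  generator∣value : ∀ ω → Y ∣ ⟪ c , ω ⟫
  generator∣value ω = sum-∣ (λ j → c j * ω j) (λ j → ∣m⇒∣m*n (ω j) (generator∣coeff j))

  modulus∣order*value : ∀ ω → N ∣ + E * ⟪ c , ω ⟫
  modulus∣order*value ω = subst (_∣ _) order*generator≡N (*-monoʳ-∣ (+ E) (generator∣value ω))

  Ker⊆⇒generator∣⟪c′,ω₀⟫ : ∀ {c′ : Fin k → ℤ} → Ker N c ⊆′ Ker N c′ → Y ∣ ⟪ c′ , ω₀ ⟫
  Ker⊆⇒generator∣⟪c′,ω₀⟫ {c′} c⊆c′ =
    *-cancelˡ-∣ (+ E) (subst₂ _∣_ (sym order*generator≡N) (⟪⟫-*ʳ c′ (+ E) ω₀)
      (c⊆c′ (λ j → + E * ω₀ j) (subst (N ∣_) (sym (⟪⟫-*ʳ c (+ E) ω₀)) (modulus∣order*value ω₀))))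

  -- ω differs from t ω₀ by a vector of Ker N c when ⟪ c , ω ⟫ = t Y.
  Ker⊆⇒values-multiple : ∀ {c′ : Fin k → ℤ} {m} → Ker N c ⊆′ Ker N c′ → ⟪ c′ , ω₀ ⟫ ≡ m * Y →
                         ∀ ω → N ∣ ⟪ c′ , ω ⟫ - m * ⟪ c , ω ⟫
  Ker⊆⇒values-multiple {c′} {m} c⊆c′ ⟪c′,ω₀⟫≡mY ω = multipleAt (generator∣value ω)
    where
    multipleAt : Y ∣ ⟪ c , ω ⟫ → N ∣ ⟪ c′ , ω ⟫ - m * ⟪ c , ω ⟫
    multipleAt (divides t ⟪c,ω⟫≡tY) = begin
      N                                     ∣⟨ c⊆c′ ω₁ ω₁∈Ker ⟩
      ⟪ c′ , ω₁ ⟫                           ≡⟨ ⟪⟫-linearʳ c′ 1ℤ (- t) ω ω₀ ⟩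
      1ℤ * ⟪ c′ , ω ⟫ + - t * ⟪ c′ , ω₀ ⟫   ≡⟨ cong (λ v → 1ℤ * ⟪ c′ , ω ⟫ + - t * v) ⟪c′,ω₀⟫≡mY ⟩
      1ℤ * ⟪ c′ , ω ⟫ + - t * (m * Y)       ≡⟨ regroup ⟪ c′ , ω ⟫ t m Y ⟩
      ⟪ c′ , ω ⟫ - m * (t * Y)              ≡⟨ cong (λ v → ⟪ c′ , ω ⟫ - m * v) ⟪c,ω⟫≡tY ⟨
      ⟪ c′ , ω ⟫ - m * ⟪ c , ω ⟫            ∎
      where
      open ∣-Reasoning
      ω₁ : Fin k → ℤ
      ω₁ j = 1ℤ * ω j + - t * ω₀ j
      regroup : ∀ x t m y → 1ℤ * x + - t * (m * y) ≡ x - m * (t * y)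
      regroup = solve-∀
      regroup′ : ∀ x t y → - t * (x - y) ≡ 1ℤ * (t * y) + - t * x
      regroup′ = solve-∀
      ω₁∈Ker : N ∣ ⟪ c , ω₁ ⟫
      ω₁∈Ker = begin
        N                                  ∣⟨ ∣n⇒∣m*n (- t) N∣⟪c,ω₀⟫-Y ⟩
        - t * (⟪ c , ω₀ ⟫ - Y)             ≡⟨ regroup′ ⟪ c , ω₀ ⟫ t Y ⟩
        1ℤ * (t * Y) + - t * ⟪ c , ω₀ ⟫    ≡⟨ cong (λ v → 1ℤ * v + - t * ⟪ c , ω₀ ⟫) ⟪c,ω⟫≡tY ⟨
        1ℤ * ⟪ c , ω ⟫ + - t * ⟪ c , ω₀ ⟫  ≡⟨ ⟪⟫-linearʳ c 1ℤ (- t) ω ω₀ ⟨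
        ⟪ c , ω₁ ⟫                         ∎

  Ker⊆⇒multiple : ∀ {c′ : Fin k → ℤ} → Ker N c ⊆′ Ker N c′ → ∃ λ m → ∀ j → N ∣ c′ j - m * c j
  Ker⊆⇒multiple {c′} c⊆c′ = multiple (Ker⊆⇒generator∣⟪c′,ω₀⟫ {c′} c⊆c′)
    where
    multiple : Y ∣ ⟪ c′ , ω₀ ⟫ → ∃ λ m → ∀ j → N ∣ c′ j - m * c j
    multiple (divides m ⟪c′,ω₀⟫≡mY) = m , λ j →
      subst₂ (λ u v → N ∣ u - m * v) (⟪⟫-δʳ c′ j) (⟪⟫-δʳ c j) (Ker⊆⇒values-multiple {c′} {m} c⊆c′ ⟪c′,ω₀⟫≡mY (δ j))

  multiple-mod-order : ∀ {c′ : Fin k → ℤ} m m′ → + E ∣ m - m′ → (∀ j → N ∣ c′ j - m * c j) → ∀ j → N ∣ c′ j - m′ * c j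
  multiple-mod-order {c′} m m′ E∣m-m′ h j = begin
    N                                ∣⟨ ∣m∣n⇒∣m+n (h j) (∣-trans (modulus∣order*coeff j) (*-monoˡ-∣ (c j) E∣m-m′)) ⟩
    c′ j - m * c j + (m - m′) * c j  ≡⟨ regroup (c′ j) m m′ (c j) ⟩
    c′ j - m′ * c j                  ∎
    where
    open ∣-Reasoning
    regroup : ∀ x m m′ y → x - m * y + (m - m′) * y ≡ x - m′ * y
    regroup = solve-∀

  generator-order : ∀ e → N ∣ + e * ⟪ c , ω₀ ⟫ → E ∣ₙ e
  generator-order e N∣e⟪c,ω₀⟫ = ∣⇒∣ᵤ (*-cancelʳ-∣ Y {+ E} {+ e} (begin
    + E * Y                                    ≡⟨ order*generator≡N ⟩
    N                                          ∣⟨ ∣m∣n⇒∣m-n N∣e⟪c,ω₀⟫ (∣n⇒∣m*n (+ e) N∣⟪c,ω₀⟫-Y) ⟩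
    + e * ⟪ c , ω₀ ⟫ - + e * (⟪ c , ω₀ ⟫ - Y)  ≡⟨ cancel (+ e) ⟪ c , ω₀ ⟫ Y ⟩
    + e * Y                                    ∎))
    where
    open ∣-Reasoning
    cancel : ∀ e x y → e * x - e * (x - y) ≡ e * y
    cancel = solve-∀

  -- With m = m′ g and E = e′ g for g = gcd m E, the vector e′ ω₀ lies in Ker N c′, hence in Ker N c.
  multiple-coprime : ∀ {c′ : Fin k → ℤ} m → (∀ j → N ∣ c′ j - + m * c j) → Ker N c′ ⊆′ Ker N c → gcd m E ≡ 1
  multiple-coprime {c′} m h c′⊆c = coprime (gcd[m,n]∣m m E) (gcd[m,n]∣n m E)
    where
    g : ℕ
    g = gcd m E
    coprime : g ∣ₙ m → g ∣ₙ E → g ≡ 1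
    coprime (ℕ.divides m′ m≡m′g) (ℕ.divides e′ E≡e′g) =
      ℕ.∣1⇒≡1 (ℕ.*-cancelˡ-∣ e′ (subst₂ _∣ₙ_ E≡e′g (sym (ℕ.*-identityʳ e′)) (generator-order e′ N∣e′⟪c,ω₀⟫)))
      where
      instance
        e′-nonZero : ℕ.NonZero e′
        e′-nonZero = ℕ.m*n≢0⇒m≢0 e′ {{subst ℕ.NonZero E≡e′g order-nonZero}}
      cancel : ∀ e x m g y → e * (x - m * g * y) + m * (e * g * y) ≡ e * x
      cancel = solve-∀
      N∣e′⟪c′,ω₀⟫ : N ∣ + e′ * ⟪ c′ , ω₀ ⟫
      N∣e′⟪c′,ω₀⟫ = begin
        N
          ∣⟨ ∣m∣n⇒∣m+n (∣n⇒∣m*n (+ e′) (⟪⟫-congˡ-mod (+ m) {c} {c′} h ω₀))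
                       (∣n⇒∣m*n (+ m′) (modulus∣order*value ω₀)) ⟩
        + e′ * (⟪ c′ , ω₀ ⟫ - + m * ⟪ c , ω₀ ⟫) + + m′ * (+ E * ⟪ c , ω₀ ⟫)
          ≡⟨ cong₂ (λ u v → + e′ * (⟪ c′ , ω₀ ⟫ - u * ⟪ c , ω₀ ⟫) + + m′ * (v * ⟪ c , ω₀ ⟫))
                   (trans (cong +_ m≡m′g) (ℤ.pos-* m′ g)) (trans (cong +_ E≡e′g) (ℤ.pos-* e′ g)) ⟩
        + e′ * (⟪ c′ , ω₀ ⟫ - + m′ * + g * ⟪ c , ω₀ ⟫) + + m′ * (+ e′ * + g * ⟪ c , ω₀ ⟫)
          ≡⟨ cancel (+ e′) ⟪ c′ , ω₀ ⟫ (+ m′) (+ g) ⟪ c , ω₀ ⟫ ⟩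
        + e′ * ⟪ c′ , ω₀ ⟫
          ∎
        where open ∣-Reasoning
      N∣e′⟪c,ω₀⟫ : N ∣ + e′ * ⟪ c , ω₀ ⟫
      N∣e′⟪c,ω₀⟫ = subst (N ∣_) (⟪⟫-*ʳ c (+ e′) ω₀)
                     (c′⊆c (λ j → + e′ * ω₀ j) (subst (N ∣_) (sym (⟪⟫-*ʳ c′ (+ e′) ω₀)) N∣e′⟪c′,ω₀⟫))

  coprime-multiple⇒Ker⊇ : ∀ {c′ : Fin k → ℤ} m → gcd m E ≡ 1 → (∀ j → N ∣ c′ j - + m * c j) → Ker N c′ ⊆′ Ker N c
  coprime-multiple⇒Ker⊇ {c′} m m⊥E h ω ω∈Ker = inKer (generator∣value ω)
    where
    N∣m*⟪c,ω⟫ : N ∣ + m * ⟪ c , ω ⟫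
    N∣m*⟪c,ω⟫ = Equivalence.to (∣-sub⇒∣⇔∣ (⟪⟫-congˡ-mod (+ m) {c} {c′} h ω)) ω∈Ker
    inKer : Y ∣ ⟪ c , ω ⟫ → N ∣ ⟪ c , ω ⟫
    inKer (divides t ⟪c,ω⟫≡tY) = begin
      N          ≡⟨ order*generator≡N ⟨
      + E * Y    ∣⟨ *-monoˡ-∣ Y (∣ᵤ⇒∣ {+ E} {t} (coprime-divisor (+ E) (+ m) t (coprime-sym (gcd≡1⇒coprime m⊥E)) (∣⇒∣ᵤ E∣m*t))) ⟩
      t * Y      ≡⟨ ⟪c,ω⟫≡tY ⟨
      ⟪ c , ω ⟫  ∎
      where
      open ∣-Reasoning
      m*⟪c,ω⟫≡m*t*Y : + m * ⟪ c , ω ⟫ ≡ + m * t * Y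
      m*⟪c,ω⟫≡m*t*Y = trans (cong (+ m *_) ⟪c,ω⟫≡tY) (sym (ℤ.*-assoc (+ m) t Y))
      E∣m*t : + E ∣ + m * t
      E∣m*t = *-cancelʳ-∣ Y (subst₂ _∣_ (sym order*generator≡N) m*⟪c,ω⟫≡m*t*Y N∣m*⟪c,ω⟫)

  Ker≐⇔unit-multiple : ∀ {c′ : Fin k → ℤ} → (Ker N c ≐′ Ker N c′) ⇔
                       (∃[ m ] (1 ≤ m × m ≤ E × gcd m E ≡ 1 × (∀ j → N ∣ c′ j - + m * c j)))
  Ker≐⇔unit-multiple {c′} = mk⇔ to from
    where
    to : Ker N c ≐′ Ker N c′ → ∃[ m ] (1 ≤ m × m ≤ E × gcd m E ≡ 1 × (∀ j → N ∣ c′ j - + m * c j))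
    to (c⊆c′ , c′⊆c) = reduce (Ker⊆⇒multiple {c′} c⊆c′)
      where
      reduce : (∃ λ m₀ → ∀ j → N ∣ c′ j - m₀ * c j) →
               ∃[ m ] (1 ≤ m × m ≤ E × gcd m E ≡ 1 × (∀ j → N ∣ c′ j - + m * c j))
      reduce (m₀ , h₀) = m , s≤s z≤n , mod⁺-≤ m₀ E , multiple-coprime {c′} m h c′⊆c , h
        where
        m : ℕ
        m = m₀ mod⁺ E
        h : ∀ j → N ∣ c′ j - + m * c j
        h = multiple-mod-order {c′} m₀ (+ m) (mod⁺-∣ m₀ E) h₀
    from : ∃[ m ] (1 ≤ m × m ≤ E × gcd m E ≡ 1 × (∀ j → N ∣ c′ j - + m * c j)) → Ker N c ≐′ Ker N c′
    from (m , _ , _ , m⊥E , h) = multiple⇒Ker⊆ (+ m) {c} {c′} h , coprime-multiple⇒Ker⊇ {c′} m m⊥E h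

-- The character of β

module _ {n} (r : Fin (suc n) → ℕ) where

  modulus : ℤ
  modulus = + rLast r

  cofactor : Fin (suc n) → ℕ
  cofactor j = rLast r ÷ r j

  coeff : (Fin (suc n) → ℕ) → Fin (suc n) → ℤ
  coeff β j = + (cofactor j ℕ.* β j)

  order : (Fin (suc n) → ℕ) → Fin (suc n) → ℕ
  order β j = r j ÷ gcd (r j) (β j)

  InA⇔Ker : ∀ β ω → InA r β ω ⇔ Ker modulus (coeff β) (λ j → + ω j)
  InA⇔Ker β ω = mk⇔ (λ h → subst (modulus ∣_) sum≡⟪⟫ (∣ᵤ⇒∣ h))
                    (λ h → ∣⇒∣ᵤ (subst (modulus ∣_) (sym sum≡⟪⟫) h))
    where
    term≡ : ∀ j → + (cofactor j ℕ.* ω j ℕ.* β j) ≡ coeff β j * + ω j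
    term≡ j = trans (cong +_ (xy∙z≈xz∙y (cofactor j) (ω j) (β j))) (ℤ.pos-* (cofactor j ℕ.* β j) (ω j))
    sum≡⟪⟫ : + Vec.sum (tabulate (λ j → cofactor j ℕ.* ω j ℕ.* β j)) ≡ ⟪ coeff β , (λ j → + ω j) ⟫
    sum≡⟪⟫ = trans (pos-sum-tabulate (λ j → cofactor j ℕ.* ω j ℕ.* β j)) (sum-cong-≗ term≡)

r∣rLast : ∀ {n} (r : Fin (suc n) → ℕ) → DivChain r → ∀ j → r j ∣ₙ rLast r
r∣rLast {zero}  r _     zero    = ℕ.∣-refl
r∣rLast {suc n} r chain zero    = ℕ.∣-trans (chain zero) (r∣rLast (λ j → r (suc j)) (λ j → chain (suc j)) zero)
r∣rLast {suc n} r chain (suc j) = r∣rLast (λ j → r (suc j)) (λ j → chain (suc j)) j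

module _ {n} (r : Fin (suc n) → ℕ) (pos : Positive r) (chain : DivChain r) where

  private
    r-nonZero : ∀ j → ℕ.NonZero (r j)
    r-nonZero j = ℕ.>-nonZero (pos j)

  cofactor*r≡rLast : ∀ j → cofactor r j ℕ.* r j ≡ rLast r
  cofactor*r≡rLast j = ÷*-cancel (pos j) (r∣rLast r chain j)

  cofactor*r≡modulus : ∀ j → + cofactor r j * + r j ≡ modulus r
  cofactor*r≡modulus j = trans (sym (ℤ.pos-* (cofactor r j) (r j))) (cong +_ (cofactor*r≡rLast j))

  reduce : (Fin (suc n) → ℤ) → Fin (suc n) → ℕ
  reduce ω j = _mod⁺_ (ω j) (r j) {{r-nonZero j}}

  Ker-reduce : ∀ β ω → Ker (modulus r) (coeff r β) ω ⇔ Ker (modulus r) (coeff r β) (λ j → + reduce ω j)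
  Ker-reduce β ω = ∣-sub⇒∣⇔∣ (⟪⟫-congʳ-mod {c = coeff r β} {ω} N∣coeff*[ω-reduce])
    where
    N∣coeff*[ω-reduce] : ∀ j → modulus r ∣ coeff r β j * (ω j - + reduce ω j)
    N∣coeff*[ω-reduce] j =
      subst₂ _∣_ (cofactor*r≡modulus j)
        (trans (sym (ℤ.*-assoc (+ cofactor r j) (+ β j) _)) (cong (_* _) (sym (ℤ.pos-* (cofactor r j) (β j)))))
        (*-monoʳ-∣ (+ cofactor r j) (∣n⇒∣m*n (+ β j) (mod⁺-∣ (ω j) (r j) {{r-nonZero j}})))

  Equiv⇔Ker≐ : ∀ β β′ → Equiv r β β′ ⇔ (Ker (modulus r) (coeff r β) ≐′ Ker (modulus r) (coeff r β′))
  Equiv⇔Ker≐ β β′ = mk⇔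
    (λ β∼β′ → Ker⊆ {β} {β′} (λ ω ω∈R† → Equivalence.to (β∼β′ ω ω∈R†)) ,
              Ker⊆ {β′} {β} (λ ω ω∈R† → Equivalence.from (β∼β′ ω ω∈R†)))
    (λ (β⊆β′ , β′⊆β) ω _ → mk⇔ (InA⊆ {β} {β′} β⊆β′ ω) (InA⊆ {β′} {β} β′⊆β ω))
    where
    Ker⊆ : ∀ {γ γ′} → (∀ ω → InRdag r ω → InA r γ ω → InA r γ′ ω) →
           Ker (modulus r) (coeff r γ) ⊆′ Ker (modulus r) (coeff r γ′)
    Ker⊆ {γ} {γ′} InA⊆InA ω ω∈Ker =
      Equivalence.from (Ker-reduce γ′ ω) (Equivalence.to (InA⇔Ker r γ′ (reduce ω))
        (InA⊆InA (reduce ω) (λ j → s≤s z≤n , mod⁺-≤ (ω j) (r j) {{r-nonZero j}})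
          (Equivalence.from (InA⇔Ker r γ (reduce ω)) (Equivalence.to (Ker-reduce γ ω) ω∈Ker))))
    InA⊆ : ∀ {γ γ′} → Ker (modulus r) (coeff r γ) ⊆′ Ker (modulus r) (coeff r γ′) →
           ∀ ω → InA r γ ω → InA r γ′ ω
    InA⊆ {γ} {γ′} γ⊆γ′ ω ω∈A = Equivalence.from (InA⇔Ker r γ′ ω) (γ⊆γ′ (λ j → + ω j) (Equivalence.to (InA⇔Ker r γ ω) ω∈A))

  coeff-multiple⇔scale : ∀ β β′ m j → β′ j ℕ.< r j →
                         (modulus r ∣ coeff r β′ j - + m * coeff r β j) ⇔ (β′ j ≡ scale r m β j)
  coeff-multiple⇔scale β β′ m j β′<r = mk⇔
    (λ h → Equivalence.to (∣-sub⇔≡mod (pos j) β′<r)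
             (*-cancelˡ-∣ (+ d) (subst₂ _∣_ (sym (cofactor*r≡modulus j)) factor h)))
    (λ eq → subst₂ _∣_ (cofactor*r≡modulus j) (sym factor)
              (*-monoʳ-∣ (+ d) (Equivalence.from (∣-sub⇔≡mod (pos j) β′<r) eq)))
    where
    d : ℕ
    d = cofactor r j
    instance
      cofactor-nonZero : ℕ.NonZero d
      cofactor-nonZero =
        ℕ.m*n≢0⇒m≢0 d {{subst ℕ.NonZero (sym (cofactor*r≡rLast j)) (r-nonZero (fromℕ n))}}
    factor : coeff r β′ j - + m * coeff r β j ≡ + d * (+ β′ j - + (m ℕ.* β j))
    factor = begin
      + (d ℕ.* β′ j) - + m * + (d ℕ.* β j)
        ≡⟨ cong₂ (λ u v → u - + m * v) (ℤ.pos-* d (β′ j)) (ℤ.pos-* d (β j)) ⟩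
      + d * + β′ j - + m * (+ d * + β j)  ≡⟨ distrib (+ d) (+ β′ j) (+ m) (+ β j) ⟩
      + d * (+ β′ j - + m * + β j)        ≡⟨ cong (λ v → + d * (+ β′ j - v)) (ℤ.pos-* m (β j)) ⟨
      + d * (+ β′ j - + (m ℕ.* β j))      ∎
      where
      open ≡-Reasoning
      distrib : ∀ d b′ m b → d * b′ - m * (d * b) ≡ d * (b′ - m * b)
      distrib = solve-∀

  multiple⇔scale : ∀ β β′ m → InR' r β′ →
                   (∀ j → modulus r ∣ coeff r β′ j - + m * coeff r β j) ⇔ (∀ j → β′ j ≡ scale r m β j)
  multiple⇔scale β β′ m β′∈R′ = mk⇔
    (λ h j → Equivalence.to (coeff-multiple⇔scale β β′ m j (β′∈R′ j)) (h j))
    (λ h j → Equivalence.from (coeff-multiple⇔scale β β′ m j (β′∈R′ j)) (h j))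

  order*gcd≡r : ∀ β j → order r β j ℕ.* gcd (r j) (β j) ≡ r j
  order*gcd≡r β j = ÷*-cancel
    (ℕ.n≢0⇒n>0 (gcd[m,n]≢0 (r j) (β j) (inj₁ (ℕ.≢-nonZero⁻¹ (r j) {{r-nonZero j}}))))
    (gcd[m,n]∣m (r j) (β j))

  modulus∣e*coeff : ∀ β j → modulus r ∣ + e r β * coeff r β j
  modulus∣e*coeff β j = subst (modulus r ∣_) (ℤ.pos-* (e r β) _) (∣ᵤ⇒∣ (begin
    rLast r                                            ≡⟨ cofactor*r≡rLast j ⟨
    cofactor r j ℕ.* r j                               ≡⟨ cong (cofactor r j ℕ.*_) (order*gcd≡r β j) ⟨
    cofactor r j ℕ.* (order r β j ℕ.* gcd (r j) (β j)) ∣⟨ ℕ.*-monoʳ-∣ (cofactor r j) (ℕ.*-pres-∣ order∣e (gcd[m,n]∣n (r j) (β j))) ⟩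
    cofactor r j ℕ.* (e r β ℕ.* β j)                   ≡⟨ x∙yz≈y∙xz (cofactor r j) (e r β) (β j) ⟩
    e r β ℕ.* (cofactor r j ℕ.* β j)                   ∎))
    where
    open ℕ.∣-Reasoning
    order∣e : order r β j ∣ₙ e r β
    order∣e = ∈⇒∣foldr-lcm (∈-map⁺ (order r β) (∈-allFin j))

  attained-order : ∀ β j → AttainedCofactor (modulus r) (coeff r β) (order r β j)
  attained-order β j = + (cofactor r j ℕ.* g) , order*cofactor*g≡N , fromBézout (bézout (r j) (β j))
    where
    g : ℕ
    g = gcd (r j) (β j)
    order*cofactor*g≡N : + order r β j * + (cofactor r j ℕ.* g) ≡ modulus r
    order*cofactor*g≡N = trans (sym (ℤ.pos-* (order r β j) _)) (cong +_ (begin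
      order r β j ℕ.* (cofactor r j ℕ.* g) ≡⟨ x∙yz≈y∙xz (order r β j) (cofactor r j) g ⟩
      cofactor r j ℕ.* (order r β j ℕ.* g) ≡⟨ cong (cofactor r j ℕ.*_) (order*gcd≡r β j) ⟩
      cofactor r j ℕ.* r j                 ≡⟨ cofactor*r≡rLast j ⟩
      rLast r                              ∎))
      where open ≡-Reasoning
    distrib : ∀ d x r y b → d * (x * r + y * b) ≡ x * (d * r) + y * (d * b)
    distrib = solve-∀
    fromBézout : (∃₂ λ x y → + g ≡ x * + r j + y * + β j) → Attained (modulus r) (coeff r β) (+ (cofactor r j ℕ.* g))
    fromBézout (x , y , g≡) = subst (Attained (modulus r) (coeff r β)) (sym value≡)
                                (attained-linear {c = coeff r β} x y (attained-modulus {c = coeff r β}) (attained-coeff {c = coeff r β} j))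
      where
      value≡ : + (cofactor r j ℕ.* g) ≡ x * modulus r + y * coeff r β j
      value≡ = begin
        + (cofactor r j ℕ.* g)                                        ≡⟨ ℤ.pos-* (cofactor r j) g ⟩
        + cofactor r j * + g                                          ≡⟨ cong (+ cofactor r j *_) g≡ ⟩
        + cofactor r j * (x * + r j + y * + β j)                      ≡⟨ distrib (+ cofactor r j) x (+ r j) y (+ β j) ⟩
        x * (+ cofactor r j * + r j) + y * (+ cofactor r j * + β j)
          ≡⟨ cong₂ (λ u v → x * u + y * v) (cofactor*r≡modulus j) (sym (ℤ.pos-* (cofactor r j) (β j))) ⟩
        x * modulus r + y * coeff r β j                               ∎
        where open ≡-Reasoning

  attained-lcm-orders : ∀ β L → AttainedCofactor (modulus r) (coeff r β) (foldr lcm 1 (map (order r β) L))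
  attained-lcm-orders β []      = modulus r , ℤ.*-identityˡ (modulus r) , attained-modulus {c = coeff r β}
  attained-lcm-orders β (j ∷ L) = attained-lcm {c = coeff r β} order≢0 (attained-order β j) (attained-lcm-orders β L)
    where
    order≢0 : order r β j ≢ 0
    order≢0 order≡0 = ℕ.≢-nonZero⁻¹ (r j) {{r-nonZero j}}
      (trans (sym (order*gcd≡r β j)) (cong (ℕ._* gcd (r j) (β j)) order≡0))

  cyclicImage : ∀ β → ∃ λ Y → CyclicImage (modulus r) (coeff r β) (e r β) Y
  cyclicImage β = image (attained-lcm-orders β (allFin (suc n)))
    where
    image : AttainedCofactor (modulus r) (coeff r β) (e r β) → ∃ λ Y → CyclicImage (modulus r) (coeff r β) (e r β) Y
    image (Y , EY≡N , Y-attained) = Y , record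
      { modulus≢0           = λ N≡0 → ℕ.≢-nonZero⁻¹ (rLast r) {{r-nonZero (fromℕ n)}} (ℤ.+-injective N≡0)
      ; order*generator≡N   = EY≡N
      ; modulus∣order*coeff = modulus∣e*coeff β
      ; generator-attained  = Y-attained
      }

corollary4p9 : (n : ℕ) (r : Fin (suc n) → ℕ) → Positive r → DivChain r →
    (β β' : Fin (suc n) → ℕ) → InR' r β → InR' r β' →
    Equiv r β β' ⇔ (∃[ m ] ((1 ≤ m) × (m ≤ e r β) × (gcd m (e r β) ≡ 1) × (∀ j → β' j ≡ scale r m β j)))
corollary4p9 n r pos chain β β′ _ β′∈R′ = begin
  Equiv r β β′
    ∼⟨ Equiv⇔Ker≐ r pos chain β β′ ⟩
  (Ker N (coeff r β) ≐′ Ker N (coeff r β′))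
    ∼⟨ Ker≐⇔unit-multiple (proj₂ (cyclicImage r pos chain β)) {coeff r β′} ⟩
  (∃[ m ] (1 ≤ m × m ≤ E × gcd m E ≡ 1 × (∀ j → N ∣ coeff r β′ j - + m * coeff r β j)))
    ∼⟨ mk⇔ (λ (m , 1≤m , m≤E , m⊥E , h) → m , 1≤m , m≤E , m⊥E , Equivalence.to (scale⇔ m) h)
           (λ (m , 1≤m , m≤E , m⊥E , h) → m , 1≤m , m≤E , m⊥E , Equivalence.from (scale⇔ m) h) ⟩
  (∃[ m ] (1 ≤ m × m ≤ E × gcd m E ≡ 1 × (∀ j → β′ j ≡ scale r m β j)))
    ∎
  where
  open EquationalReasoning
  N : ℤ
  N = modulus r
  E : ℕ
  E = e r β
  scale⇔ : ∀ m → (∀ j → N ∣ coeff r β′ j - + m * coeff r β j) ⇔ (∀ j → β′ j ≡ scale r m β j)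
  scale⇔ m = multiple⇔scale r pos chain β β′ m β′∈R′
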